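{- Let $(F_n)_{n\ge 1}$ be the Fibonacci sequence ($F_1=F_2=1$, $F_{n+2}=F_{n+1}+F_n$) and put $F_0=1$. For $s\ge 0$ let $\Phi_s=\{\langle j,s\rangle : 1\le j\le F_s\}$, $V=\bigcup_{p\ge 0}\Phi_p$, and let $E=\{(\langle j,p\rangle,\langle q,p+1\rangle): p\ge 0,\ 1\le j\le F_p,\ 1\le q\le F_{p+1}\}$. Define the partial order $\le_P$ on $V$ by $\langle s,t\rangle\le_P\langle u,v\rangle$ iff $t<v$ or ($t=v$ and $s=u$) (the Fibonacci cobweb poset). Define linear orders $X$ and $Y$ on $V$ by $\langle s,t\rangle\le_X\langle u,v\rangle$ iff $t<v$ or ($t=v$ and $s\le u$), and $\langle s,t\rangle\le_Y\langle u,v\rangle$ iff $t<v$ or ($t=v$ and $s\ge u$). Then $X$ and $Y$ are linear extensions of $\le_P$ and $\le_P = X\cap Y$. Consequently the digraph $(V,E)$ is orderable (an oDAG): $(V,\le_P)$ is a poset of dimension $2$ whose Hasse diagram coincides with the digraph $(V,E)$.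
   Context: A linear extension of a partial order $R$ on a set $A$ is a linear order $L$ on $A$ with $a\le_R b \Rightarrow a\le_L b$. The dimension of a partial order $R$ is the least $s$ such that $R$ is the intersection of $s$ linear extensions of $R$. A directed acyclic graph is orderable (oDAG) if there is a poset of dimension 2 whose Hasse diagram coincides with it. -}

module Defs where

open import Level using (0ℓ)
open import Data.Nat using (ℕ; zero; suc; _+_; _≤_; _<_)
open import Data.Fin as Fin using (Fin)
open import Data.Product using (Σ; ∃; _×_; _,_)
open import Data.Sum using (_⊎_)
open import Relation.Nullary using (¬_)
open import Relation.Binary.Core using (Rel; _⇒_)
open import Relation.Binary.Structures using (IsTotalOrder; IsPartialOrder)
open import Relation.Binary.PropositionalEquality using (_≡_)
open import Function.Bundles using (_⇔_)

fib : ℕ → ℕ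
fib zero = zero
fib (suc zero) = suc zero
fib (suc (suc n)) = fib (suc n) + fib n

F : ℕ → ℕ
F zero = suc zero
F (suc n) = fib (suc n)

record Vertex : Set where
  constructor ⟨_,_⟩[_,_]
  field
    idx : ℕ
    lvl : ℕ
    .lo : 1 ≤ idx
    .hi : idx ≤ F lvl
open Vertex public

E : Rel Vertex 0ℓ
E a b = lvl b ≡ suc (lvl a)

_≤P_ : Rel Vertex 0ℓ
a ≤P b = (lvl a < lvl b) ⊎ (lvl a ≡ lvl b × idx a ≡ idx b)

_≤X_ : Rel Vertex 0ℓ
a ≤X b = (lvl a < lvl b) ⊎ (lvl a ≡ lvl b × idx a ≤ idx b)

_≤Y_ : Rel Vertex 0ℓ
a ≤Y b = (lvl a < lvl b) ⊎ (lvl a ≡ lvl b × idx b ≤ idx a)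

XY : Fin 2 → Rel Vertex 0ℓ
XY Fin.zero = _≤X_
XY (Fin.suc _) = _≤Y_

module _ {A : Set} where

  IsLinearExtension : Rel A 0ℓ → Rel A 0ℓ → Set
  IsLinearExtension R L = IsTotalOrder _≡_ L × (R ⇒ L)

  IsIntersectionOf : {s : ℕ} → Rel A 0ℓ → (Fin s → Rel A 0ℓ) → Set
  IsIntersectionOf R Ls = ∀ a b → R a b ⇔ (∀ i → Ls i a b)

  Realizable : Rel A 0ℓ → ℕ → Set₁
  Realizable R s = Σ (Fin s → Rel A 0ℓ) λ Ls →
    (∀ i → IsLinearExtension R (Ls i)) × IsIntersectionOf R Ls

  HasDimension : Rel A 0ℓ → ℕ → Set₁
  HasDimension R d = Realizable R d × (∀ s → s < d → ¬ Realizable R s)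

  _<[_]_ : A → Rel A 0ℓ → A → Set
  a <[ R ] b = R a b × ¬ (a ≡ b)

  Covers : Rel A 0ℓ → Rel A 0ℓ
  Covers R a b = a <[ R ] b × ¬ (∃ λ c → a <[ R ] c × c <[ R ] b)

  HasseIs : Rel A 0ℓ → Rel A 0ℓ → Set
  HasseIs R G = ∀ a b → Covers R a b ⇔ G a b

  Orderable : Rel A 0ℓ → Set₁
  Orderable G = Σ (Rel A 0ℓ) λ R →
    IsPartialOrder _≡_ R × HasDimension R 2 × HasseIs R G

-- Both ≤X and ≤Y compare levels first, and within a level they order the indices in opposite
-- directions, so their intersection keeps exactly the cross-level comparisons and the
-- identities: this is ≤P. Since a level of size F 3 = 2 holds two incomparable vertices, no
-- single linear order realizes ≤P, so its dimension is 2. Every level is nonempty, hence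
-- ⟨j,p⟩ < ⟨q,r⟩ is a covering exactly when r = p + 1, i.e. the Hasse diagram is E.
module Submission where

open import Defs
open import Data.Product using (_×_)
open import Relation.Binary.Structures using (IsPartialOrder)
open import Relation.Binary.PropositionalEquality using (_≡_)

open import Level using (0ℓ)
open import Data.Nat using (ℕ; zero; suc; _≤_; _<_; z≤n; s≤s)
open import Data.Nat.Properties
  using (≤-refl; ≤-reflexive; ≤-trans; ≤-antisym; ≤-isTotalOrder; m≤m+n
        ; <-trans; <-≤-trans; ≤-<-trans; <-irrefl; <-asym; <-cmp; ≤⇒≯; m≤n⇒m<n∨m≡n)
open import Data.Fin using (zero; suc)
open import Data.Product using (_,_; proj₁; uncurry)
open import Data.Sum using (_⊎_; inj₁; inj₂)
open import Data.Empty using (⊥-elim)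
open import Function using (flip)
open import Function.Bundles using (mk⇔; Equivalence)
open import Relation.Nullary using (¬_)
open import Relation.Binary.Core using (Rel; _⇒_)
open import Relation.Binary.Definitions
  using (Reflexive; Transitive; Antisymmetric; Total; tri<; tri≈; tri>)
open import Relation.Binary.Structures using (IsTotalOrder)
open import Relation.Binary.Construct.Intersection using (_∩_)
import Relation.Binary.Construct.Flip.EqAndOrd as Flip
open import Relation.Binary.PropositionalEquality
  using (_≢_; refl; sym; trans; subst; isEquivalence; isPartialOrder)

vertex-≡ : ∀ {a b : Vertex} → idx a ≡ idx b → lvl a ≡ lvl b → a ≡ b
vertex-≡ {⟨ _ , _ ⟩[ _ , _ ]} {⟨ _ , _ ⟩[ _ , _ ]} refl refl = refl

1≤fib-suc : ∀ n → 1 ≤ fib (suc n)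
1≤fib-suc zero    = ≤-refl
1≤fib-suc (suc n) = ≤-trans (1≤fib-suc n) (m≤m+n _ _)

1≤F : ∀ n → 1 ≤ F n
1≤F zero    = ≤-refl
1≤F (suc n) = 1≤fib-suc n

firstVertexAt : ℕ → Vertex
firstVertexAt n = ⟨ 1 , n ⟩[ ≤-refl , 1≤F n ]

-- _≤P_, _≤X_ and _≤Y_ are, definitionally, Lex _≡_, Lex _≤_ and Lex (flip _≤_).
-- Since Lex R a b only mentions the fields of a and b, Agda cannot infer the vertices
-- from it; hence the explicit vertex arguments {a} {b} below.
Lex : Rel ℕ 0ℓ → Rel Vertex 0ℓ
Lex R a b = (lvl a < lvl b) ⊎ (lvl a ≡ lvl b × R (idx a) (idx b))

module _ {R : Rel ℕ 0ℓ} where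

  Lex-reflexive : Reflexive R → ∀ {a b} → a ≡ b → Lex R a b
  Lex-reflexive R-refl refl = inj₂ (refl , R-refl)

  Lex-trans : Transitive R → Transitive (Lex R)
  Lex-trans _       (inj₁ p)       (inj₁ q)         = inj₁ (<-trans p q)
  Lex-trans _       (inj₁ p)       (inj₂ (e , _))   = inj₁ (<-≤-trans p (≤-reflexive e))
  Lex-trans _       (inj₂ (e , _)) (inj₁ q)         = inj₁ (≤-<-trans (≤-reflexive e) q)
  Lex-trans R-trans (inj₂ (e , r)) (inj₂ (e′ , r′)) = inj₂ (trans e e′ , R-trans r r′)

  Lex-antisym : Antisymmetric _≡_ R → Antisymmetric _≡_ (Lex R)
  Lex-antisym _         (inj₁ p)       (inj₁ q)        = ⊥-elim (<-asym p q)
  Lex-antisym _         (inj₁ p)       (inj₂ (e , _))  = ⊥-elim (<-irrefl (sym e) p)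
  Lex-antisym _         (inj₂ (e , _)) (inj₁ q)        = ⊥-elim (<-irrefl (sym e) q)
  Lex-antisym R-antisym (inj₂ (e , r)) (inj₂ (_ , r′)) = vertex-≡ (R-antisym r r′) e

  Lex-total : Total R → Total (Lex R)
  Lex-total R-total a b with <-cmp (lvl a) (lvl b) | R-total (idx a) (idx b)
  ... | tri< p _ _ | _      = inj₁ (inj₁ p)
  ... | tri> _ _ p | _      = inj₂ (inj₁ p)
  ... | tri≈ _ e _ | inj₁ r = inj₁ (inj₂ (e , r))
  ... | tri≈ _ e _ | inj₂ r = inj₂ (inj₂ (sym e , r))

  Lex-isPartialOrder : IsPartialOrder _≡_ R → IsPartialOrder _≡_ (Lex R)
  Lex-isPartialOrder po = record
    { isPreorder = record
      { isEquivalence = isEquivalence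
      ; reflexive     = Lex-reflexive P.refl
      ; trans         = λ {a b c} → Lex-trans P.trans {a} {b} {c}
      }
    ; antisym = Lex-antisym P.antisym
    }
    where module P = IsPartialOrder po

  Lex-isTotalOrder : IsTotalOrder _≡_ R → IsTotalOrder _≡_ (Lex R)
  Lex-isTotalOrder to = record
    { isPartialOrder = Lex-isPartialOrder T.isPartialOrder
    ; total          = Lex-total T.total
    }
    where module T = IsTotalOrder to

  Lex-mono : ∀ {S : Rel ℕ 0ℓ} → R ⇒ S → Lex R ⇒ Lex S
  Lex-mono _    (inj₁ p)       = inj₁ p
  Lex-mono R⇒S (inj₂ (e , r)) = inj₂ (e , R⇒S r)

  Lex-∩ : ∀ {S : Rel ℕ 0ℓ} {a b} → Lex R a b → Lex S a b → Lex (R ∩ S) a b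
  Lex-∩ (inj₁ p)       _              = inj₁ p
  Lex-∩ (inj₂ _)       (inj₁ q)       = inj₁ q
  Lex-∩ (inj₂ (e , r)) (inj₂ (_ , s)) = inj₂ (e , r , s)

module _ {A : Set} {R : Rel A 0ℓ} where

  incomparable⇒¬Realizable<2 : ∀ {a b} → ¬ R a b → ¬ R b a → ∀ s → s < 2 → ¬ Realizable R s
  incomparable⇒¬Realizable<2 {a} {b} a≰b _ zero _ (_ , _ , R≡⋂) =
    a≰b (Equivalence.from (R≡⋂ a b) λ ())
  incomparable⇒¬Realizable<2 {a} {b} a≰b b≰a (suc zero) _ (_ , ext , R≡⋂)
    with IsTotalOrder.total (proj₁ (ext zero)) a b
  ... | inj₁ r = a≰b (Equivalence.from (R≡⋂ a b) λ { zero → r })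
  ... | inj₂ r = b≰a (Equivalence.from (R≡⋂ b a) λ { zero → r })
  incomparable⇒¬Realizable<2 _ _ (suc (suc _)) (s≤s (s≤s ()))

≤P-isPartialOrder : IsPartialOrder _≡_ _≤P_
≤P-isPartialOrder = Lex-isPartialOrder isPartialOrder

≤P⇒≤X : _≤P_ ⇒ _≤X_
≤P⇒≤X {a} {b} = Lex-mono {R = _≡_} ≤-reflexive {a} {b}

≤P⇒≤Y : _≤P_ ⇒ _≤Y_
≤P⇒≤Y {a} {b} = Lex-mono {R = _≡_} (λ e → ≤-reflexive (sym e)) {a} {b}

≤X∩≤Y⇒≤P : _≤X_ ∩ _≤Y_ ⇒ _≤P_
≤X∩≤Y⇒≤P {a} {b} (x , y) =
  Lex-mono {R = _≤_ ∩ flip _≤_} {S = _≡_} (uncurry ≤-antisym) {a} {b}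
    (Lex-∩ {R = _≤_} {S = flip _≤_} {a} {b} x y)

≤X-isLinearExtension : IsLinearExtension _≤P_ _≤X_
≤X-isLinearExtension = Lex-isTotalOrder ≤-isTotalOrder , λ {a b} → ≤P⇒≤X {a} {b}

≤Y-isLinearExtension : IsLinearExtension _≤P_ _≤Y_
≤Y-isLinearExtension = Lex-isTotalOrder (Flip.isTotalOrder ≤-isTotalOrder) , λ {a b} → ≤P⇒≤Y {a} {b}

≤P-isIntersectionOf-XY : IsIntersectionOf _≤P_ XY
≤P-isIntersectionOf-XY a b = mk⇔ to from
  where
  to : a ≤P b → ∀ i → XY i a b
  to p zero    = ≤P⇒≤X {a} {b} p
  to p (suc _) = ≤P⇒≤Y {a} {b} p
  from : (∀ i → XY i a b) → a ≤P b
  from h = ≤X∩≤Y⇒≤P {a} {b} (h zero , h (suc zero))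

≤P-realizable : Realizable _≤P_ 2
≤P-realizable = XY , extensions , ≤P-isIntersectionOf-XY
  where
  extensions : ∀ i → IsLinearExtension _≤P_ (XY i)
  extensions zero    = ≤X-isLinearExtension
  extensions (suc _) = ≤Y-isLinearExtension

sameLevel-≢⇒≰P : ∀ {a b} → lvl a ≡ lvl b → idx a ≢ idx b → ¬ a ≤P b
sameLevel-≢⇒≰P e _    (inj₁ p)       = <-irrefl e p
sameLevel-≢⇒≰P _ i≢j (inj₂ (_ , i)) = i≢j i

≤P-hasDimension2 : HasDimension _≤P_ 2
≤P-hasDimension2 = ≤P-realizable , incomparable⇒¬Realizable<2 {a = v₁} {b = v₂}
  (sameLevel-≢⇒≰P {v₁} {v₂} refl λ ()) (sameLevel-≢⇒≰P {v₂} {v₁} refl λ ())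
  where
  v₁ v₂ : Vertex
  v₁ = ⟨ 1 , 3 ⟩[ ≤-refl , 1≤F 3 ]
  v₂ = ⟨ 2 , 3 ⟩[ s≤s z≤n , ≤-refl ]

<P⇒lvl< : ∀ {a b} → a <[ _≤P_ ] b → lvl a < lvl b
<P⇒lvl< (inj₁ p       , _)   = p
<P⇒lvl< (inj₂ (e , i) , a≢b) = ⊥-elim (a≢b (vertex-≡ i e))

lvl<⇒<P : ∀ {a b} → lvl a < lvl b → a <[ _≤P_ ] b
lvl<⇒<P p = inj₁ p , λ { refl → <-irrefl refl p }

≤P-hasseIs-E : HasseIs _≤P_ E
≤P-hasseIs-E a b = mk⇔ covers⇒E E⇒covers
  where
  covers⇒E : Covers _≤P_ a b → E a b
  covers⇒E (a<b , nothingBetween) with m≤n⇒m<n∨m≡n (<P⇒lvl< {a} {b} a<b)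
  ... | inj₂ e = sym e
  ... | inj₁ p = ⊥-elim (nothingBetween (c , lvl<⇒<P {a} {c} ≤-refl , lvl<⇒<P {c} {b} p))
    where
    c : Vertex
    c = firstVertexAt (suc (lvl a))
  E⇒covers : E a b → Covers _≤P_ a b
  E⇒covers e = lvl<⇒<P {a} {b} (≤-reflexive (sym e)) , λ (c , a<c , c<b) →
    ≤⇒≯ (<P⇒lvl< {a} {c} a<c) (subst (lvl c <_) e (<P⇒lvl< {c} {b} c<b))

mainTheorem2 : IsLinearExtension _≤P_ _≤X_
    × IsLinearExtension _≤P_ _≤Y_
    × IsIntersectionOf _≤P_ XY
    × IsPartialOrder _≡_ _≤P_
    × HasDimension _≤P_ 2
    × HasseIs _≤P_ E
    × Orderable E
mainTheorem2 =
  ≤X-isLinearExtension , ≤Y-isLinearExtension , ≤P-isIntersectionOf-XY ,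
  ≤P-isPartialOrder , ≤P-hasDimension2 , ≤P-hasseIs-E ,
  (_≤P_ , ≤P-isPartialOrder , ≤P-hasDimension2 , ≤P-hasseIs-E)
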